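{- Let $n\ge1$ and $a,k\in[2n]$. There exists a permutation $\sigma^{(a,k)}\in S_{2n}$ such that for every $P\in\mathcal{D}_n$, $u_{a,k}(P)=h_k\big(\sigma^{(a,k)}(P)\big)$.
   Context: A Dyck path of size $n$ is a word $P_1\cdots P_{2n}$ in $\mathtt{u},\mathtt{d}$ with $n$ of each letter whose every prefix has at least as many $\mathtt{u}$'s as $\mathtt{d}$'s; $\mathcal{D}_n$ is their set. The tunneling $\tau_P\in S_{2n}$ is the fixed-point-free involution pairing each up-step position with the position of its matching down-step. For $\sigma\in S_{2n}$, $\sigma_k=\sigma(k)$, $\sigma_{[k]}=\{\sigma_1,\dots,\sigma_k\}$; $\sigma(P)$ is the word with $\sigma(P)_k=\mathtt{u}$ if $\tau_P(\sigma_k)\notin\sigma_{[k]}$ and $\mathtt{d}$ otherwise. The height $h_k(P)$ is the number of $\mathtt{u}$'s minus the number of $\mathtt{d}$'s among $P_1,\dots,P_k$. For $S\subseteq[2n]$, a step $i\in S$ is unpaired in $S$ if $\tau_P(i)\notin S$. $u_{a,k}(P)$ is the number of unpaired steps in $I=\{a,a+1,\dots,a+k-1\}$ (indices modulo $2n$, in $[2n]$), i.e. among $k$ circularly consecutive steps of $P$ starting at step $a$. -}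

module Defs where

open import Data.Bool using (Bool; true; false; if_then_else_; not; _∧_)
open import Data.Nat using (ℕ; zero; suc; _+_; _*_; _∸_; _<ᵇ_; _%_; _<_; _≤_)
open import Data.Integer using (ℤ; +_; -[1+_]; _≤_) renaming (_+_ to _+ℤ_)
import Data.Integer as ℤ
open import Data.Fin using (Fin; toℕ; fromℕ<)
import Data.Fin as Fin
open import Data.List using (List; []; _∷_; map; length; foldr; reverse)
open import Data.Bool.ListAction using (any)
open import Data.Fin.Permutation using (Permutation′; _⟨$⟩ʳ_)
open import Data.Maybe using (Maybe; just; nothing; fromMaybe)
open import Data.Product using (_×_)
open import Relation.Binary.PropositionalEquality using (_≡_)
open import Relation.Nullary.Decidable using (⌊_⌋)

data Step : Set where
  u d : Step

-- A word of length m in {u,d}; positions are 0-indexed (Fin m), i.e. the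
-- paper's step P_{i+1} is  P i.
Word : ℕ → Set
Word m = Fin m → Step

isU : Step → Bool
isU u = true
isU d = false

stepVal : Step → ℤ
stepVal u = + 1
stepVal d = -[1+ 0 ]

sumℤ : List ℤ → ℤ
sumℤ = foldr _+ℤ_ (+ 0)

allFin : (m : ℕ) → List (Fin m)
allFin zero = []
allFin (suc m) = Fin.zero ∷ map Fin.suc (allFin m)

height : {m : ℕ} → Word m → ℕ → ℤ
height {m} P k = sumℤ (map (λ i → if toℕ i <ᵇ k then stepVal (P i) else + 0) (allFin m))

IsDyck : (n : ℕ) → Word (2 * n) → Set
IsDyck n P = ((k : ℕ) → k Data.Nat.≤ 2 * n → + 0 ℤ.≤ height P k) × (height P (2 * n) ≡ + 0)

firstSuch : {m : ℕ} → (Fin m → Bool) → List (Fin m) → Maybe (Fin m)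
firstSuch p [] = nothing
firstSuch p (x ∷ xs) = if p x then just x else firstSuch p xs

_==ℤ_ : ℤ → ℤ → Bool
x ==ℤ y = ⌊ x ℤ.≟ y ⌋

-- On a Dyck path this is the
-- usual matching (fixed-point-free involution); the fallback value (i itself)
-- never occurs for Dyck paths.
tunnel : {m : ℕ} → Word m → Fin m → Fin m
tunnel {m} P i with P i
... | u = fromMaybe i (firstSuch (λ j → (toℕ i <ᵇ toℕ j) ∧ (height P (suc (toℕ j)) ==ℤ height P (toℕ i))) (allFin m))
... | d = fromMaybe i (firstSuch (λ j → (toℕ j <ᵇ toℕ i) ∧ (height P (toℕ j) ==ℤ height P (suc (toℕ i)))) (reverse (allFin m)))

_==F_ : {m : ℕ} → Fin m → Fin m → Bool
x ==F y = ⌊ x Fin.≟ y ⌋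

-- σ(P): the k-th step (0-indexed k, paper's k+1) is u iff τ_P(σ_k) ∉ σ_{[k]},
-- where σ_{[k]} = {σ j | j ≤ k} (0-indexed).
applyPerm : {m : ℕ} → Permutation′ m → Word m → Word m
applyPerm {m} σ P k =
  if any (λ j → (toℕ j <ᵇ suc (toℕ k)) ∧ ((σ ⟨$⟩ʳ j) ==F tunnel P (σ ⟨$⟩ʳ k))) (allFin m)
  then d else u

-- membership in the circular interval I = {a, a+1, …, a+k-1} (mod m),
-- with a given 0-indexed (a0 = a - 1): i ∈ I iff (i - a0) mod m < k.
inCircInterval : (m : ℕ) → Fin m → ℕ → Fin m → Bool
inCircInterval m a0 k i = ((toℕ i + m ∸ toℕ a0) % suc (m ∸ 1)) <ᵇ k

countB : {A : Set} → (A → Bool) → List A → ℕ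
countB p [] = 0
countB p (x ∷ xs) = if p x then suc (countB p xs) else countB p xs

unpaired : {m : ℕ} → Word m → Fin m → ℕ → ℕ
unpaired {m} P a0 k =
  countB (λ i → inCircInterval m a0 k i ∧ not (inCircInterval m a0 k (tunnel P i))) (allFin m)

-- The k-th letter of σ(P) is d exactly when the tunnel partner of σ_k occurs
-- among σ_1, …, σ_k.  So σ(P) is the up/down word of the fixed-point-free
-- involution π = σ⁻¹ ∘ τ_P ∘ σ, and the height of such a word after k letters is
-- the number of arcs of π joining {1..k} to its complement; through σ these are
-- the steps of σ_[k] whose partner lies outside σ_[k].  For the rotation
-- σ_j = a + j - 1 (mod 2n) the set σ_[k] is the circular interval I, giving
-- u_{a,k}(P).  That τ_P is such an involution on a Dyck path comes from the
-- discrete intermediate value theorem for heights, which change by ±1 per step.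
module Submission where

open import Defs
open import Data.Nat using (ℕ; _*_; _≤_; _<_)
open import Data.Integer using (+_)
open import Data.Fin using (Fin; toℕ)
open import Data.Fin.Permutation using (Permutation′)
open import Data.Product using (Σ)
open import Relation.Binary.PropositionalEquality using (_≡_)

open import Algebra.Properties.CommutativeMonoid.Sum as Sum using ()
open import Data.Bool using (Bool; true; false; if_then_else_; not; _∧_; _∨_)
open import Data.Bool.ListAction using (any; or)
import Data.Bool.Properties as Boolₚ
open import Data.Empty using (⊥-elim)
open import Data.Fin using (zero; suc; fromℕ<; _≟_)
import Data.Fin.Properties as Finₚ
open import Data.Fin.Permutation using (_⟨$⟩ʳ_; _⟨$⟩ˡ_; permutation; inverseˡ; inverseʳ)
open import Data.Integer as ℤ using (ℤ; -_; -[1+_]) renaming (_+_ to _+ℤ_)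
import Data.Integer.Properties as ℤₚ
open import Data.List using ([]; _∷_; [_]; _++_; map; reverse)
import Data.List.Properties as Listₚ
open import Data.Maybe using (just; nothing; fromMaybe; maybe′)
import Data.Maybe as Maybe
open import Data.Nat as ℕ using (zero; suc; _+_; _∸_; _<ᵇ_; _%_; z<s; s<s; s≤s; s≤s⁻¹)
open import Data.Nat.DivMod using (m%n<n; %-distribˡ-+; m%n%n≡m%n; [m+n]%n≡m%n; m<n⇒m%n≡m)
import Data.Nat.Properties as ℕₚ
open import Data.Product using (_,_; _×_; ∃-syntax; proj₁; proj₂)
open import Data.Sum using (_⊎_; inj₁; inj₂)
open import Function using (_∘_)
open import Relation.Binary.Definitions using (tri<; tri≈; tri>)
open import Relation.Binary.PropositionalEquality using (_≢_; refl; sym; trans; cong; cong₂; subst; module ≡-Reasoning)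
open import Relation.Nullary using (¬_; yes; no; does)
open import Relation.Nullary.Decidable using (Dec; ⌊_⌋; dec-true; dec-false; isYes≗does)

open Sum ℤₚ.+-0-commutativeMonoid using (sum; sum-cong-≗; sum-replicate-zero; ∑-distrib-+; sum-permute)

<ᵇ-true : ∀ {m n} → m < n → (m <ᵇ n) ≡ true
<ᵇ-true {m} {n} = dec-true (m ℕₚ.<? n)

<ᵇ-false : ∀ {m n} → ¬ m < n → (m <ᵇ n) ≡ false
<ᵇ-false {m} {n} = dec-false (m ℕₚ.<? n)

⌊⌋-true : ∀ {A : Set} (a? : Dec A) → A → ⌊ a? ⌋ ≡ true
⌊⌋-true a? a = trans (isYes≗does a?) (dec-true a? a)

⌊⌋-false : ∀ {A : Set} (a? : Dec A) → ¬ A → ⌊ a? ⌋ ≡ false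
⌊⌋-false a? ¬a = trans (isYes≗does a?) (dec-false a? ¬a)

<ᵇ-∧-false : ∀ {m n} {b : Bool} → (m < n → b ≡ false) → ((m <ᵇ n) ∧ b) ≡ false
<ᵇ-∧-false {m} {n} b≡false with m ℕₚ.<? n
... | yes m<n rewrite <ᵇ-true m<n = b≡false m<n
... | no m≮n rewrite <ᵇ-false m≮n = refl

n<ᵇ1+n : ∀ n → (n <ᵇ suc n) ≡ true
n<ᵇ1+n n = <ᵇ-true (ℕₚ.n<1+n n)

n<ᵇn : ∀ n → (n <ᵇ n) ≡ false
n<ᵇn n = <ᵇ-false {n} (ℕₚ.<-irrefl refl)

<ᵇ-suc : ∀ {m n} → m ≢ n → (m <ᵇ suc n) ≡ (m <ᵇ n)
<ᵇ-suc {m} {n} m≢n with ℕₚ.<-cmp m n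
... | tri< m<n _ _ = trans (<ᵇ-true (ℕₚ.m<n⇒m<1+n m<n)) (sym (<ᵇ-true m<n))
... | tri≈ _ m≡n _ = ⊥-elim (m≢n m≡n)
... | tri> _ _ m>n = trans (<ᵇ-false (ℕₚ.≤⇒≯ m>n)) (sym (<ᵇ-false (ℕₚ.<⇒≯ m>n)))

not-<ᵇ-suc : ∀ {m n} → m ≢ n → not (m <ᵇ suc n) ≡ (n <ᵇ m)
not-<ᵇ-suc {m} {n} m≢n with ℕₚ.<-cmp m n
... | tri< m<n _ _ rewrite <ᵇ-true (ℕₚ.m<n⇒m<1+n m<n) = sym (<ᵇ-false (ℕₚ.<⇒≯ m<n))
... | tri≈ _ m≡n _ = ⊥-elim (m≢n m≡n)
... | tri> _ _ m>n rewrite <ᵇ-false (ℕₚ.≤⇒≯ m>n) = sym (<ᵇ-true m>n)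

indicator : Bool → ℤ
indicator b = if b then + 1 else + 0

point : ∀ {m} → Fin m → ℤ → Fin m → ℤ
point i x j = if does (j ≟ i) then x else + 0

sumℤ-allFin : ∀ {m} (f : Fin m → ℤ) → sumℤ (map f (allFin m)) ≡ sum f
sumℤ-allFin {zero} f = refl
sumℤ-allFin {suc m} f =
  cong (f zero +ℤ_) (trans (cong sumℤ (sym (Listₚ.map-∘ (allFin m)))) (sumℤ-allFin (f ∘ suc)))

countB-sumℤ : ∀ {A : Set} (p : A → Bool) xs → + countB p xs ≡ sumℤ (map (indicator ∘ p) xs)
countB-sumℤ p [] = refl
countB-sumℤ p (x ∷ xs) with p x
... | true = cong (+ 1 +ℤ_) (countB-sumℤ p xs)
... | false = trans (countB-sumℤ p xs) (sym (ℤₚ.+-identityˡ _))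

sum-point : ∀ {m} (i : Fin m) x → sum (point i x) ≡ x
sum-point {suc m} zero x = trans (cong (x +ℤ_) (sum-replicate-zero m)) (ℤₚ.+-identityʳ x)
sum-point {suc m} (suc i) x = trans (ℤₚ.+-identityˡ _) (sum-point i x)

any-map : ∀ {A B : Set} (p : B → Bool) (f : A → B) xs → any p (map f xs) ≡ any (p ∘ f) xs
any-map p f xs = cong or (sym (Listₚ.map-∘ xs))

any-false : ∀ {A : Set} (p : A → Bool) → (∀ x → p x ≡ false) → ∀ xs → any p xs ≡ false
any-false p none [] = refl
any-false p none (x ∷ xs) rewrite none x = any-false p none xs

any-allFin-unique : ∀ {m} (p : Fin m → Bool) {j} → (∀ i → i ≢ j → p i ≡ false) →
                    any p (allFin m) ≡ p j
any-allFin-unique {suc m} p {zero} others = begin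
  p zero ∨ any p (map suc (allFin m)) ≡⟨ cong (p zero ∨_) (any-map p suc (allFin m)) ⟩
  p zero ∨ any (p ∘ suc) (allFin m)   ≡⟨ cong (p zero ∨_) (any-false (p ∘ suc) (λ i → others (suc i) λ ()) (allFin m)) ⟩
  p zero ∨ false                      ≡⟨ Boolₚ.∨-identityʳ (p zero) ⟩
  p zero                              ∎
  where open ≡-Reasoning
any-allFin-unique {suc m} p {suc j} others rewrite others zero (λ ()) =
  trans (any-map p suc (allFin m)) (any-allFin-unique (p ∘ suc) (λ i i≢j → others (suc i) (i≢j ∘ Finₚ.suc-injective)))

firstSuch-map : ∀ {m n} (p : Fin n → Bool) (f : Fin m → Fin n) xs →
                firstSuch p (map f xs) ≡ Maybe.map f (firstSuch (p ∘ f) xs)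
firstSuch-map p f [] = refl
firstSuch-map p f (x ∷ xs) with p (f x)
... | true = refl
... | false = firstSuch-map p f xs

firstSuch-++ : ∀ {m} (p : Fin m → Bool) xs ys →
               firstSuch p (xs ++ ys) ≡ maybe′ just (firstSuch p ys) (firstSuch p xs)
firstSuch-++ p [] ys = refl
firstSuch-++ p (x ∷ xs) ys with p x
... | true = refl
... | false = firstSuch-++ p xs ys

firstSuch-none : ∀ {m} (p : Fin m → Bool) → (∀ i → p i ≡ false) → ∀ xs → firstSuch p xs ≡ nothing
firstSuch-none p none [] = refl
firstSuch-none p none (x ∷ xs) rewrite none x = firstSuch-none p none xs

firstSuch-allFin-least : ∀ {m} (p : Fin m → Bool) {j} → p j ≡ true →
                         (∀ i → toℕ i < toℕ j → p i ≡ false) → firstSuch p (allFin m) ≡ just j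
firstSuch-allFin-least {suc m} p {zero} pj _ rewrite pj = refl
firstSuch-allFin-least {suc m} p {suc j} pj earlier
  rewrite earlier zero z<s | firstSuch-map p suc (allFin m)
        | firstSuch-allFin-least (p ∘ suc) pj (λ i i<j → earlier (suc i) (s<s i<j)) = refl

reverse-allFin-suc : ∀ m → reverse (allFin (suc m)) ≡ map suc (reverse (allFin m)) ++ [ zero ]
reverse-allFin-suc m = trans (Listₚ.unfold-reverse zero (map suc (allFin m)))
                             (cong (_++ [ zero ]) (sym (Listₚ.reverse-map suc (allFin m))))

firstSuch-reverse-allFin-greatest : ∀ {m} (p : Fin m → Bool) {j} → p j ≡ true →
  (∀ i → toℕ j < toℕ i → p i ≡ false) → firstSuch p (reverse (allFin m)) ≡ just j
firstSuch-reverse-allFin-greatest {suc m} p {j} pj later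
  rewrite reverse-allFin-suc m | firstSuch-++ p (map suc (reverse (allFin m))) [ zero ]
        | firstSuch-map p suc (reverse (allFin m)) = lastSearch j pj later
  where
  lastSearch : ∀ j → p j ≡ true → (∀ i → toℕ j < toℕ i → p i ≡ false) →
    maybe′ just (firstSuch p [ zero ]) (Maybe.map suc (firstSuch (p ∘ suc) (reverse (allFin m)))) ≡ just j
  lastSearch zero pj later
    rewrite firstSuch-none (p ∘ suc) (λ i → later (suc i) z<s) (reverse (allFin m)) | pj = refl
  lastSearch (suc j) pj later
    rewrite firstSuch-reverse-allFin-greatest (p ∘ suc) pj (λ i j<i → later (suc i) (s<s j<i)) = refl

stepsBefore : ∀ {m} → Word m → ℕ → Fin m → ℤ
stepsBefore W k i = if toℕ i <ᵇ k then stepVal (W i) else + 0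

height-sum : ∀ {m} (W : Word m) k → height W k ≡ sum (stepsBefore W k)
height-sum W k = sumℤ-allFin (stepsBefore W k)

height-zero : ∀ {m} (W : Word m) → height W 0 ≡ + 0
height-zero {m} W = trans (height-sum W 0) (sum-replicate-zero m)

height-suc : ∀ {m} (W : Word m) (i : Fin m) → height W (suc (toℕ i)) ≡ height W (toℕ i) +ℤ stepVal (W i)
height-suc W i = begin
  height W (suc k)                                        ≡⟨ height-sum W (suc k) ⟩
  sum (stepsBefore W (suc k))                             ≡⟨ sum-cong-≗ newStep ⟩
  sum (λ j → stepsBefore W k j +ℤ point i (stepVal (W i)) j) ≡⟨ ∑-distrib-+ (stepsBefore W k) _ ⟩
  sum (stepsBefore W k) +ℤ sum (point i (stepVal (W i))) ≡⟨ cong₂ _+ℤ_ (sym (height-sum W k)) (sum-point i _) ⟩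
  height W k +ℤ stepVal (W i)                             ∎
  where
  open ≡-Reasoning
  k = toℕ i
  newStep : ∀ j → stepsBefore W (suc k) j ≡ stepsBefore W k j +ℤ point i (stepVal (W i)) j
  newStep j with j ≟ i
  ... | yes refl rewrite n<ᵇ1+n k | n<ᵇn k = sym (ℤₚ.+-identityˡ _)
  ... | no j≢i rewrite <ᵇ-suc (j≢i ∘ Finₚ.toℕ-injective) = sym (ℤₚ.+-identityʳ _)

height-suc-step : ∀ {m} {W : Word m} (i : Fin m) {s} → W i ≡ s →
                  height W (suc (toℕ i)) ≡ height W (toℕ i) +ℤ stepVal s
height-suc-step {W = W} i Wi≡s = trans (height-suc W i) (cong (λ s → height W (toℕ i) +ℤ stepVal s) Wi≡s)

module Matching {m} (π : Fin m → Fin m) (π-involutive : ∀ j → π (π j) ≡ j)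
                (π-fixedPointFree : ∀ j → π j ≢ j) where

  closesArc : Fin m → Bool
  closesArc j = toℕ (π j) <ᵇ suc (toℕ j)

  arcStep : Fin m → Step
  arcStep j = if closesArc j then d else u

  crosses : ℕ → Fin m → Bool
  crosses k j = (toℕ j <ᵇ k) ∧ not (toℕ (π j) <ᵇ k)

  crossings : ℕ → ℤ
  crossings k = sum (indicator ∘ crosses k)

  crossings-suc : ∀ i → crossings (suc (toℕ i)) ≡ crossings (toℕ i) +ℤ stepVal (arcStep i)
  crossings-suc i = begin
    crossings (suc k)                                                ≡⟨ sum-cong-≗ change ⟩
    sum (λ j → indicator (crosses k j) +ℤ (opensAt j +ℤ closesAt j)) ≡⟨ ∑-distrib-+ (indicator ∘ crosses k) (λ j → opensAt j +ℤ closesAt j) ⟩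
    crossings k +ℤ sum (λ j → opensAt j +ℤ closesAt j)               ≡⟨ cong (crossings k +ℤ_) (∑-distrib-+ opensAt closesAt) ⟩
    crossings k +ℤ (sum opensAt +ℤ sum closesAt)                     ≡⟨ cong (crossings k +ℤ_) (cong₂ _+ℤ_ (sum-point i _) (sum-point (π i) _)) ⟩
    crossings k +ℤ (opens +ℤ closes)                                 ≡⟨ cong (crossings k +ℤ_) opens+closes ⟩
    crossings k +ℤ stepVal (arcStep i)                               ∎
    where
    open ≡-Reasoning
    k = toℕ i
    pk = toℕ (π i)
    pk≢k : pk ≢ k
    pk≢k = π-fixedPointFree i ∘ Finₚ.toℕ-injective
    opens closes : ℤ
    opens = indicator (k <ᵇ pk)
    closes = - indicator (pk <ᵇ k)
    opensAt closesAt : Fin m → ℤ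
    opensAt = point i opens
    closesAt = point (π i) closes
    -- Passing the cut at k only affects the arc at i: it starts crossing if i opens it, stops if i closes it.
    change : ∀ j → indicator (crosses (suc k) j) ≡ indicator (crosses k j) +ℤ (opensAt j +ℤ closesAt j)
    change j with j ≟ i | j ≟ π i
    ... | yes refl | yes i≡πi = ⊥-elim (π-fixedPointFree i (sym i≡πi))
    ... | yes refl | no _ rewrite n<ᵇ1+n k | n<ᵇn k | not-<ᵇ-suc pk≢k =
      sym (trans (ℤₚ.+-identityˡ _) (ℤₚ.+-identityʳ _))
    ... | no _ | yes refl rewrite π-involutive i | n<ᵇ1+n k | n<ᵇn k
                                | Boolₚ.∧-zeroʳ (pk <ᵇ suc k) | Boolₚ.∧-identityʳ (pk <ᵇ k) =
      sym (trans (cong (indicator (pk <ᵇ k) +ℤ_) (ℤₚ.+-identityˡ _)) (ℤₚ.+-inverseʳ (indicator (pk <ᵇ k))))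
    ... | no j≢i | no j≢πi
      rewrite <ᵇ-suc (j≢i ∘ Finₚ.toℕ-injective)
            | <ᵇ-suc (λ πj≡k → j≢πi (trans (sym (π-involutive j)) (cong π (Finₚ.toℕ-injective πj≡k)))) =
      sym (ℤₚ.+-identityʳ _)
    opens+closes : opens +ℤ closes ≡ stepVal (arcStep i)
    opens+closes with ℕₚ.<-cmp pk k
    ... | tri< pk<k _ _ rewrite <ᵇ-true (ℕₚ.m<n⇒m<1+n pk<k) | <ᵇ-false (ℕₚ.<⇒≯ pk<k) | <ᵇ-true pk<k = refl
    ... | tri≈ _ pk≡k _ = ⊥-elim (pk≢k pk≡k)
    ... | tri> _ _ pk>k rewrite <ᵇ-false (ℕₚ.≤⇒≯ pk>k) | <ᵇ-true pk>k | <ᵇ-false (ℕₚ.<⇒≯ pk>k) = refl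

  height-arcWord : (W : Word m) → (∀ j → W j ≡ arcStep j) → ∀ k → k ≤ m → height W k ≡ crossings k
  height-arcWord W W≡arcStep zero _ = trans (height-zero W) (sym (sum-replicate-zero m))
  height-arcWord W W≡arcStep (suc k) k<m with fromℕ< k<m | Finₚ.toℕ-fromℕ< k<m
  ... | i | refl = begin
    height W (suc (toℕ i))             ≡⟨ height-suc W i ⟩
    height W (toℕ i) +ℤ stepVal (W i)  ≡⟨ cong₂ (λ h s → h +ℤ stepVal s) (height-arcWord W W≡arcStep (toℕ i) (ℕₚ.<⇒≤ k<m)) (W≡arcStep i) ⟩
    crossings (toℕ i) +ℤ stepVal (arcStep i) ≡⟨ sym (crossings-suc i) ⟩
    crossings (suc (toℕ i))            ∎
    where open ≡-Reasoning

+stepVal-u : ∀ x → x +ℤ stepVal u ≡ ℤ.suc x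
+stepVal-u x = ℤₚ.+-comm x (+ 1)

+stepVal-d : ∀ x → x +ℤ stepVal d ≡ ℤ.pred x
+stepVal-d x = ℤₚ.+-comm x -[1+ 0 ]

<+stepVal-u : ∀ x → x ℤ.< x +ℤ stepVal u
<+stepVal-u x = subst (x ℤ.<_) (sym (+stepVal-u x)) (ℤₚ.i≤pred[j]⇒i<j (ℤₚ.≤-reflexive (sym (ℤₚ.pred-suc x))))

+stepVal-d< : ∀ x → x +ℤ stepVal d ℤ.< x
+stepVal-d< x = subst (ℤ._< x) (sym (+stepVal-d x)) (ℤₚ.i≤pred[j]⇒i<j ℤₚ.≤-refl)

<⇒≤-+stepVal : ∀ s {c x} → c ℤ.< x → c ℤ.≤ x +ℤ stepVal s
<⇒≤-+stepVal u {c} {x} c<x = subst (c ℤ.≤_) (sym (+stepVal-u x)) (ℤₚ.≤-trans (ℤₚ.<⇒≤ c<x) (ℤₚ.i≤suc[i] x))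
<⇒≤-+stepVal d {c} {x} c<x = subst (c ℤ.≤_) (sym (+stepVal-d x)) (ℤₚ.i<j⇒i≤pred[j] c<x)

<+stepVal⇒≤ : ∀ s {c x} → c ℤ.< x +ℤ stepVal s → c ℤ.≤ x
<+stepVal⇒≤ u {c} {x} c<x+1 = subst (c ℤ.≤_) (ℤₚ.pred-suc x) (ℤₚ.i<j⇒i≤pred[j] (subst (c ℤ.<_) (+stepVal-u x) c<x+1))
<+stepVal⇒≤ d {c} {x} c<x-1 = ℤₚ.<⇒≤ (ℤₚ.<-trans c<x-1 (+stepVal-d< x))

UnitSteps : (ℕ → ℤ) → ℕ → Set
UnitSteps f b = ∀ s → s < b → ∃[ st ] f (suc s) ≡ f s +ℤ stepVal st

module _ {f : ℕ → ℤ} {b : ℕ} (unitSteps : UnitSteps f b) {c : ℤ} where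

  <⇒≤-next : ∀ {s} → s < b → c ℤ.< f s → c ℤ.≤ f (suc s)
  <⇒≤-next {s} s<b c<fs with unitSteps s s<b
  ... | st , fs+1≡ = subst (c ℤ.≤_) (sym fs+1≡) (<⇒≤-+stepVal st c<fs)

  <-next⇒≤ : ∀ {s} → s < b → c ℤ.< f (suc s) → c ℤ.≤ f s
  <-next⇒≤ {s} s<b c<fs+1 with unitSteps s s<b
  ... | st , fs+1≡ = <+stepVal⇒≤ st (subst (c ℤ.<_) fs+1≡ c<fs+1)

  first-descent : ∀ {a} → a ≤ b → c ℤ.< f a → f b ℤ.≤ c →
    ∃[ s ] a < s × s ≤ b × f s ≡ c × (∀ r → a ≤ r → r < s → c ℤ.< f r)
  first-descent {a} a≤b = descend (b ∸ a) a (ℕₚ.m+[n∸m]≡n a≤b)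
    where
    descend : ∀ δ a → a + δ ≡ b → c ℤ.< f a → f b ℤ.≤ c →
      ∃[ s ] a < s × s ≤ b × f s ≡ c × (∀ r → a ≤ r → r < s → c ℤ.< f r)
    descend zero a a+0≡b c<fa fb≤c =
      ⊥-elim (ℤₚ.<-irrefl refl (ℤₚ.<-≤-trans c<fa (subst (λ x → f x ℤ.≤ c) (sym (trans (sym (ℕₚ.+-identityʳ a)) a+0≡b)) fb≤c)))
    descend (suc δ) a a+δ+1≡b c<fa fb≤c with f (suc a) ℤ.≟ c
    ... | yes fa+1≡c = suc a , ℕₚ.n<1+n a , sa≤b , fa+1≡c ,
                       λ r a≤r r<a+1 → subst (λ x → c ℤ.< f x) (ℕₚ.≤-antisym a≤r (s≤s⁻¹ r<a+1)) c<fa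
      where
      sa≤b : suc a ≤ b
      sa≤b = subst (suc a ≤_) a+δ+1≡b (ℕₚ.≤-trans (s≤s (ℕₚ.m≤m+n a δ)) (ℕₚ.≤-reflexive (sym (ℕₚ.+-suc a δ))))
    ... | no fa+1≢c with descend δ (suc a) (trans (sym (ℕₚ.+-suc a δ)) a+δ+1≡b) c<fa+1 fb≤c
      where
      c<fa+1 : c ℤ.< f (suc a)
      c<fa+1 = ℤₚ.≤∧≢⇒< (<⇒≤-next (subst (a <_) a+δ+1≡b (ℕₚ.m<m+n a z<s)) c<fa) (fa+1≢c ∘ sym)
    ...   | s , a+1<s , s≤b , fs≡c , above = s , ℕₚ.<-trans (ℕₚ.n<1+n a) a+1<s , s≤b , fs≡c , above′
      where
      above′ : ∀ r → a ≤ r → r < s → c ℤ.< f r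
      above′ r a≤r r<s with ℕₚ.m≤n⇒m<n∨m≡n a≤r
      ... | inj₁ a<r = above r a<r r<s
      ... | inj₂ refl = c<fa

  last-ascent : ∀ t → t ≤ b → f 0 ℤ.≤ c → c ℤ.< f t →
    ∃[ x ] x < t × f x ≡ c × (∀ s → x < s → s ≤ t → c ℤ.< f s)
  last-ascent zero _ f0≤c c<f0 = ⊥-elim (ℤₚ.<-irrefl refl (ℤₚ.≤-<-trans f0≤c c<f0))
  last-ascent (suc t) t<b f0≤c c<ft+1 with f t ℤ.≟ c
  ... | yes ft≡c = t , ℕₚ.n<1+n t , ft≡c ,
                   λ s t<s s≤t+1 → subst (λ x → c ℤ.< f x) (ℕₚ.≤-antisym t<s s≤t+1) c<ft+1
  ... | no ft≢c with last-ascent t (ℕₚ.<⇒≤ t<b) f0≤c (ℤₚ.≤∧≢⇒< (<-next⇒≤ t<b c<ft+1) (ft≢c ∘ sym))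
  ...   | x , x<t , fx≡c , above = x , ℕₚ.m<n⇒m<1+n x<t , fx≡c , above′
    where
    above′ : ∀ s → x < s → s ≤ suc t → c ℤ.< f s
    above′ s x<s s≤t+1 with ℕₚ.m≤n⇒m<n∨m≡n s≤t+1
    ... | inj₁ s<t+1 = above s x<s (s≤s⁻¹ s<t+1)
    ... | inj₂ refl = c<ft+1

height-unitSteps : ∀ {m} (P : Word m) → UnitSteps (height P) m
height-unitSteps P s s<m =
  P (fromℕ< s<m) , subst (λ t → height P (suc t) ≡ height P t +ℤ stepVal (P (fromℕ< s<m))) (Finₚ.toℕ-fromℕ< s<m) (height-suc P (fromℕ< s<m))

record Arc {m} (P : Word m) (x y : ℕ) : Set where
  field
    opener<closer : x < y
    returns : height P (suc y) ≡ height P x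
    stays-above : ∀ s → x < s → s ≤ y → height P x ℤ.< height P s

module _ {m} {P : Word m} {i j : Fin m} (arc : Arc P (toℕ i) (toℕ j)) where
  open Arc arc

  private
    H : ℕ → ℤ
    H = height P

  arc-up : P i ≡ u
  arc-up with P i in Pi≡
  ... | u = refl
  ... | d = ⊥-elim (ℤₚ.<-irrefl refl (ℤₚ.<-trans (stays-above (suc (toℕ i)) (ℕₚ.n<1+n _) opener<closer)
                                                  (subst (ℤ._< H (toℕ i)) (sym (height-suc-step i Pi≡)) (+stepVal-d< _))))

  arc-down : P j ≡ d
  arc-down with P j in Pj≡
  ... | d = refl
  ... | u = ⊥-elim (ℤₚ.<-irrefl refl (ℤₚ.<-trans (stays-above (toℕ j) opener<closer ℕₚ.≤-refl)
                                                  (subst (H (toℕ j) ℤ.<_) (trans (sym (height-suc-step j Pj≡)) returns) (<+stepVal-u _))))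

  tunnel-arcˡ : tunnel P i ≡ j
  tunnel-arcˡ rewrite arc-up =
    cong (fromMaybe i) (firstSuch-allFin-least _ matches earlier)
    where
    matches : ((toℕ i <ᵇ toℕ j) ∧ (H (suc (toℕ j)) ==ℤ H (toℕ i))) ≡ true
    matches rewrite <ᵇ-true opener<closer = ⌊⌋-true (_ ℤ.≟ _) returns
    earlier : ∀ x → toℕ x < toℕ j → ((toℕ i <ᵇ toℕ x) ∧ (H (suc (toℕ x)) ==ℤ H (toℕ i))) ≡ false
    earlier x x<j = <ᵇ-∧-false λ i<x → ⌊⌋-false (_ ℤ.≟ _) λ Hx+1≡Hi →
      ℤₚ.<-irrefl (sym Hx+1≡Hi) (stays-above (suc (toℕ x)) (ℕₚ.m<n⇒m<1+n i<x) x<j)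

  tunnel-arcʳ : tunnel P j ≡ i
  tunnel-arcʳ rewrite arc-down =
    cong (fromMaybe j) (firstSuch-reverse-allFin-greatest _ matches later)
    where
    matches : ((toℕ i <ᵇ toℕ j) ∧ (H (toℕ i) ==ℤ H (suc (toℕ j)))) ≡ true
    matches rewrite <ᵇ-true opener<closer = ⌊⌋-true (_ ℤ.≟ _) (sym returns)
    later : ∀ x → toℕ i < toℕ x → ((toℕ x <ᵇ toℕ j) ∧ (H (toℕ x) ==ℤ H (suc (toℕ j)))) ≡ false
    later x i<x = <ᵇ-∧-false λ x<j → ⌊⌋-false (_ ℤ.≟ _) λ Hx≡Hj+1 →
      ℤₚ.<-irrefl (sym (trans Hx≡Hj+1 returns)) (stays-above (toℕ x) i<x (ℕₚ.<⇒≤ x<j))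

module _ {n} {P : Word (2 * n)} (dyck : IsDyck n P) where
  private
    H : ℕ → ℤ
    H = height P

  arc-from-up : ∀ {i} → P i ≡ u → ∃[ j ] Arc P (toℕ i) (toℕ j)
  arc-from-up {i} Pi≡u with first-descent (height-unitSteps P) (Finₚ.toℕ<n i) Ht<Ht+1 H2n≤Ht
    where
    t = toℕ i
    Ht<Ht+1 : H t ℤ.< H (suc t)
    Ht<Ht+1 = subst (H t ℤ.<_) (sym (height-suc-step i Pi≡u)) (<+stepVal-u (H t))
    H2n≤Ht : H (2 * n) ℤ.≤ H t
    H2n≤Ht = subst (ℤ._≤ H t) (sym (proj₂ dyck)) (proj₁ dyck t (ℕₚ.<⇒≤ (Finₚ.toℕ<n i)))
  ... | suc s , s≤s t<s , s<2n , Hs≡Ht , above =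
    fromℕ< s<2n , subst (Arc P (toℕ i)) (sym (Finₚ.toℕ-fromℕ< s<2n)) record
      { opener<closer = t<s
      ; returns = Hs≡Ht
      ; stays-above = λ r t<r r≤s → above r t<r (s≤s r≤s)
      }

  arc-to-down : ∀ {j} → P j ≡ d → ∃[ i ] Arc P (toℕ i) (toℕ j)
  arc-to-down {j} Pj≡d
    with last-ascent (height-unitSteps P) t (ℕₚ.<⇒≤ t<2n) H0≤Ht+1 Ht+1<Ht
    where
    t = toℕ j
    t<2n : t < 2 * n
    t<2n = Finₚ.toℕ<n j
    H0≤Ht+1 : H 0 ℤ.≤ H (suc t)
    H0≤Ht+1 = subst (ℤ._≤ H (suc t)) (sym (height-zero P)) (proj₁ dyck (suc t) t<2n)
    Ht+1<Ht : H (suc t) ℤ.< H t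
    Ht+1<Ht = subst (ℤ._< H t) (sym (height-suc-step j Pj≡d)) (+stepVal-d< (H t))
  ... | x , x<t , Hx≡Ht+1 , above =
    fromℕ< x<2n , subst (λ z → Arc P z (toℕ j)) (sym (Finₚ.toℕ-fromℕ< x<2n)) record
      { opener<closer = x<t
      ; returns = sym Hx≡Ht+1
      ; stays-above = λ s x<s s≤t → subst (ℤ._< H s) (sym Hx≡Ht+1) (above s x<s s≤t)
      }
    where
    x<2n : x < 2 * n
    x<2n = ℕₚ.<-trans x<t (Finₚ.toℕ<n j)

  tunnel-arc : ∀ i → Arc P (toℕ i) (toℕ (tunnel P i)) ⊎ Arc P (toℕ (tunnel P i)) (toℕ i)
  tunnel-arc i = byStep (P i) refl
    where
    byStep : ∀ s → P i ≡ s → Arc P (toℕ i) (toℕ (tunnel P i)) ⊎ Arc P (toℕ (tunnel P i)) (toℕ i)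
    byStep u Pi≡u with arc-from-up Pi≡u
    ... | j , arc = inj₁ (subst (λ z → Arc P (toℕ i) (toℕ z)) (sym (tunnel-arcˡ arc)) arc)
    byStep d Pi≡d with arc-to-down Pi≡d
    ... | i′ , arc = inj₂ (subst (λ z → Arc P (toℕ z) (toℕ i)) (sym (tunnel-arcʳ arc)) arc)

  tunnel-involutive : ∀ i → tunnel P (tunnel P i) ≡ i
  tunnel-involutive i with tunnel-arc i
  ... | inj₁ arc = tunnel-arcʳ arc
  ... | inj₂ arc = tunnel-arcˡ arc

  tunnel-fixedPointFree : ∀ i → tunnel P i ≢ i
  tunnel-fixedPointFree i τi≡i with tunnel-arc i
  ... | inj₁ arc = ℕₚ.<-irrefl (cong toℕ (sym τi≡i)) (Arc.opener<closer arc)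
  ... | inj₂ arc = ℕₚ.<-irrefl (cong toℕ τi≡i) (Arc.opener<closer arc)

inPrefix : ∀ {m} → Permutation′ m → ℕ → Fin m → Bool
inPrefix σ k i = toℕ (σ ⟨$⟩ˡ i) <ᵇ k

module _ {m} {P : Word m} (τ-involutive : ∀ i → tunnel P (tunnel P i) ≡ i)
         (τ-fixedPointFree : ∀ i → tunnel P i ≢ i) (σ : Permutation′ m) where
  private
    τ : Fin m → Fin m
    τ = tunnel P

    π : Fin m → Fin m
    π j = σ ⟨$⟩ˡ τ (σ ⟨$⟩ʳ j)

    π-involutive : ∀ j → π (π j) ≡ j
    π-involutive j = begin
      σ ⟨$⟩ˡ τ (σ ⟨$⟩ʳ (σ ⟨$⟩ˡ τ (σ ⟨$⟩ʳ j))) ≡⟨ cong (λ x → σ ⟨$⟩ˡ τ x) (inverseʳ σ) ⟩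
      σ ⟨$⟩ˡ τ (τ (σ ⟨$⟩ʳ j))                 ≡⟨ cong (σ ⟨$⟩ˡ_) (τ-involutive _) ⟩
      σ ⟨$⟩ˡ (σ ⟨$⟩ʳ j)                       ≡⟨ inverseˡ σ ⟩
      j                                        ∎
      where open ≡-Reasoning

    π-fixedPointFree : ∀ j → π j ≢ j
    π-fixedPointFree j πj≡j = τ-fixedPointFree (σ ⟨$⟩ʳ j) (trans (sym (inverseʳ σ)) (cong (σ ⟨$⟩ʳ_) πj≡j))

    open Matching π π-involutive π-fixedPointFree

    applyPerm-arcStep : ∀ j → applyPerm σ P j ≡ arcStep j
    applyPerm-arcStep j = cong (λ b → if b then d else u) (begin
      any tunnelledEarlier (allFin m)                      ≡⟨ any-allFin-unique tunnelledEarlier others ⟩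
      closesArc j ∧ ((σ ⟨$⟩ʳ π j) ==F τ (σ ⟨$⟩ʳ j))        ≡⟨ cong (closesArc j ∧_) (⌊⌋-true (_ ≟ _) (inverseʳ σ)) ⟩
      closesArc j ∧ true                                   ≡⟨ Boolₚ.∧-identityʳ _ ⟩
      closesArc j                                          ∎)
      where
      open ≡-Reasoning
      tunnelledEarlier : Fin m → Bool
      tunnelledEarlier i = (toℕ i <ᵇ suc (toℕ j)) ∧ ((σ ⟨$⟩ʳ i) ==F τ (σ ⟨$⟩ʳ j))
      others : ∀ i → i ≢ π j → tunnelledEarlier i ≡ false
      others i i≢πj = trans (cong (_ ∧_) (⌊⌋-false (_ ≟ _) λ σi≡ → i≢πj (trans (sym (inverseˡ σ)) (cong (σ ⟨$⟩ˡ_) σi≡))))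
                            (Boolₚ.∧-zeroʳ _)

  height-applyPerm : ∀ k → k ≤ m →
    height (applyPerm σ P) k ≡ sum (λ i → indicator (inPrefix σ k i ∧ not (inPrefix σ k (τ i))))
  height-applyPerm k k≤m = begin
    height (applyPerm σ P) k                          ≡⟨ height-arcWord (applyPerm σ P) applyPerm-arcStep k k≤m ⟩
    crossings k                                       ≡⟨ sum-cong-≗ (λ j → cong (λ x → indicator ((toℕ x <ᵇ k) ∧ not (toℕ (π j) <ᵇ k))) (sym (inverseˡ σ))) ⟩
    sum (λ j → indicator (leaves (σ ⟨$⟩ʳ j)))          ≡⟨ sum-permute (indicator ∘ leaves) σ ⟨
    sum (λ i → indicator (leaves i))                  ∎
    where
    open ≡-Reasoning
    leaves : Fin m → Bool
    leaves i = inPrefix σ k i ∧ not (inPrefix σ k (τ i))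

rotate : ∀ {M} → ℕ → Fin (suc M) → Fin (suc M)
rotate {M} r i = fromℕ< (m%n<n (toℕ i + r) (suc M))

[m%n+k]%n≡[m+k]%n : ∀ m k n .{{_ : ℕ.NonZero n}} → (m % n + k) % n ≡ (m + k) % n
[m%n+k]%n≡[m+k]%n m k n = begin
  (m % n + k) % n         ≡⟨ %-distribˡ-+ (m % n) k n ⟩
  (m % n % n + k % n) % n ≡⟨ cong (λ x → (x + k % n) % n) (m%n%n≡m%n m n) ⟩
  (m % n + k % n) % n     ≡⟨ %-distribˡ-+ m k n ⟨
  (m + k) % n             ∎
  where open ≡-Reasoning

rotate-inverse : ∀ {M r s} → r + s ≡ suc M → ∀ i → rotate s (rotate r i) ≡ i
rotate-inverse {M} {r} {s} r+s≡N i = Finₚ.toℕ-injective (begin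
  toℕ (rotate s (rotate r i))   ≡⟨ Finₚ.toℕ-fromℕ< (m%n<n (toℕ (rotate r i) + s) N) ⟩
  (toℕ (rotate r i) + s) % N    ≡⟨ cong (λ x → (x + s) % N) (Finₚ.toℕ-fromℕ< (m%n<n (toℕ i + r) N)) ⟩
  ((toℕ i + r) % N + s) % N     ≡⟨ [m%n+k]%n≡[m+k]%n (toℕ i + r) s N ⟩
  (toℕ i + r + s) % N           ≡⟨ cong (_% N) (trans (ℕₚ.+-assoc (toℕ i) r s) (cong (λ x → toℕ i + x) r+s≡N)) ⟩
  (toℕ i + N) % N               ≡⟨ [m+n]%n≡m%n (toℕ i) N ⟩
  toℕ i % N                     ≡⟨ m<n⇒m%n≡m (Finₚ.toℕ<n i) ⟩
  toℕ i                         ∎)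
  where
  open ≡-Reasoning
  N = suc M

rotation : ∀ {M} → Fin (suc M) → Permutation′ (suc M)
rotation {M} a = permutation (rotate (toℕ a)) (rotate (suc M ∸ toℕ a))
  (rotate-inverse (ℕₚ.m∸n+n≡m a≤N)) (rotate-inverse (ℕₚ.m+[n∸m]≡n a≤N))
  where
  a≤N : toℕ a ≤ suc M
  a≤N = ℕₚ.<⇒≤ (Finₚ.toℕ<n a)

inCircInterval-rotation : ∀ {M} (a : Fin (suc M)) k i → inCircInterval (suc M) a k i ≡ inPrefix (rotation a) k i
inCircInterval-rotation {M} a k i = cong (_<ᵇ k)
  (trans (cong (_% suc M) (ℕₚ.+-∸-assoc (toℕ i) (ℕₚ.<⇒≤ (Finₚ.toℕ<n a))))
         (sym (Finₚ.toℕ-fromℕ< (m%n<n (toℕ i + (suc M ∸ toℕ a)) (suc M)))))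

theorem8 : (n : ℕ) → 1 ≤ n → (a0 : Fin (2 * n)) → (k : ℕ) → 1 ≤ k → k ≤ 2 * n →
    Σ (Permutation′ (2 * n)) (λ σ → (P : Word (2 * n)) → IsDyck n P →
      + unpaired P a0 k ≡ height (applyPerm σ P) k)
theorem8 zero () _ _ _ _
theorem8 (suc n) _ a k _ k≤2n = rotation a , λ P dyck → begin
  + unpaired P a k                                          ≡⟨ countB-sumℤ (leavesInterval P) (allFin _) ⟩
  sumℤ (map (indicator ∘ leavesInterval P) (allFin _))      ≡⟨ sumℤ-allFin (indicator ∘ leavesInterval P) ⟩
  sum (indicator ∘ leavesInterval P)                        ≡⟨ sum-cong-≗ (λ i → cong₂ (λ x y → indicator (x ∧ not y))
                                                                 (inCircInterval-rotation a k i) (inCircInterval-rotation a k (tunnel P i))) ⟩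
  sum (λ i → indicator (inPrefix σ k i ∧ not (inPrefix σ k (tunnel P i))))
                                                            ≡⟨ height-applyPerm {P = P} (tunnel-involutive {suc n} {P} dyck) (tunnel-fixedPointFree {suc n} {P} dyck) σ k k≤2n ⟨
  height (applyPerm σ P) k                                  ∎
  where
  open ≡-Reasoning
  σ = rotation a
  leavesInterval : Word (2 * suc n) → Fin (2 * suc n) → Bool
  leavesInterval P i = inCircInterval _ a k i ∧ not (inCircInterval _ a k (tunnel P i))
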